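{- Let $k$ be a cardinal number with $k>1$. Then the category $k\mathcal H$ of $k$-uniform hypergraphs does not have exponentials (i.e. it is not the case that an exponential object $G^H$ exists in $k\mathcal H$ for all objects $G,H$).
   Context: A hypergraph $H=(H(E),H(V),\varphi)$ consists of sets $H(E)$, $H(V)$ and a map $\varphi\colon H(E)\to\mathcal P(H(V))$ to the power set; a morphism is a pair of maps $f_E\colon H(E)\to H'(E)$, $f_V\colon H(V)\to H'(V)$ with $\varphi'\circ f_E=\mathcal P(f_V)\circ\varphi$ (direct image). $H$ is $k$-uniform if $\varphi(e)$ has cardinality $k$ for every $e\in H(E)$; $k\mathcal H$ is the full subcategory of the category of hypergraphs on the $k$-uniform hypergraphs. -}

module Defs where

open import Level using (0ℓ)
open import Data.Product using (Σ; _×_; _,_)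
open import Function.Bundles using (_↔_; _⇔_)
open import Relation.Binary.PropositionalEquality using (_≡_)
open import Relation.Nullary using (¬_)

-- A hypergraph H = (H(E), H(V), φ).  A subset of V is a proposition-valued
-- predicate V → Set (the power set 𝒫(V)).
record Hypergraph : Set₁ where
  field
    Edge   : Set
    Vertex : Set
    φ      : Edge → Vertex → Set
    φ-prop : ∀ e v (p q : φ e v) → p ≡ q
open Hypergraph public

⟦_⟧ : (H : Hypergraph) → Edge H → Set
⟦ H ⟧ e = Σ (Vertex H) (φ H e)

-- H is k-uniform, the cardinal k being represented by a set K:
-- every φ(e) is in bijection with K.
IsUniform : Set → Hypergraph → Set
IsUniform K H = ∀ e → ⟦ H ⟧ e ↔ K

image : {V V' : Set} → (V → V') → (V → Set) → (V' → Set)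
image {V} f S v' = Σ V λ v → S v × f v ≡ v'

-- Morphisms: φ' ∘ f_E = 𝒫(f_V) ∘ φ (equality of subsets = same members).
record Hom (H H' : Hypergraph) : Set where
  field
    fE  : Edge H → Edge H'
    fV  : Vertex H → Vertex H'
    comm : ∀ e v' → φ H' (fE e) v' ⇔ image fV (φ H e) v'
open Hom public

infix 4 _≈ₕ_
_≈ₕ_ : {H H' : Hypergraph} → Hom H H' → Hom H H' → Set
f ≈ₕ g = (∀ e → fE f e ≡ fE g e) × (∀ v → fV f v ≡ fV g v)

infixr 9 _∘ₕ_
_∘ₕ_ : {A B C : Hypergraph} → Hom B C → Hom A B → Hom A C
_∘ₕ_ {A} {B} {C} g f = record
  { fE = λ e → fE g (fE f e)
  ; fV = λ v → fV g (fV f v)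
  ; comm = λ e v'' → record
      { to = λ p → to-dir e v'' p
      ; from = λ q → from-dir e v'' q
      ; to-cong = λ { _≡_.refl → _≡_.refl }
      ; from-cong = λ { _≡_.refl → _≡_.refl } } }
  where
  open import Relation.Binary.PropositionalEquality using (refl; cong; trans)
  open Function.Bundles.Equivalence
  to-dir : ∀ e v'' → φ C (fE g (fE f e)) v'' → image (λ v → fV g (fV f v)) (φ A e) v''
  to-dir e v'' p with to (comm g (fE f e) v'') p
  ... | v' , q , refl with to (comm f e v') q
  ... | v , r , refl = v , r , refl
  from-dir : ∀ e v'' → image (λ v → fV g (fV f v)) (φ A e) v'' → φ C (fE g (fE f e)) v''
  from-dir e v'' (v , r , refl) =
    from (comm g (fE f e) (fV g (fV f v)))
      (fV f v , from (comm f e (fV f v)) (v , r , refl) , refl)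

record kObj (K : Set) : Set₁ where
  constructor kobj
  field
    hg      : Hypergraph
    uniform : IsUniform K hg
open kObj public

record kHom {K : Set} (A B : kObj K) : Set where
  constructor khom
  field
    hom : Hom (hg A) (hg B)
open kHom public

infixr 9 _∘_
_∘_ : {K : Set} {A B C : kObj K} → kHom B C → kHom A B → kHom A C
g ∘ f = khom (hom g ∘ₕ hom f)

infix 4 _≈_
_≈_ : {K : Set} {A B : kObj K} → kHom A B → kHom A B → Set
f ≈ g = hom f ≈ₕ hom g

record IsProduct {K : Set} (A B P : kObj K)
                 (π₁ : kHom P A) (π₂ : kHom P B) : Set₁ where
  field
    ⟨_,_⟩   : {X : kObj K} → kHom X A → kHom X B → kHom X P
    β₁      : {X : kObj K} (f : kHom X A) (g : kHom X B) → π₁ ∘ ⟨ f , g ⟩ ≈ f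
    β₂      : {X : kObj K} (f : kHom X A) (g : kHom X B) → π₂ ∘ ⟨ f , g ⟩ ≈ g
    unique  : {X : kObj K} (f : kHom X A) (g : kHom X B) (h : kHom X P) →
              π₁ ∘ h ≈ f → π₂ ∘ h ≈ g → h ≈ ⟨ f , g ⟩

record Exponential {K : Set} (G H : kObj K) : Set₁ where
  field
    E       : kObj K
    EH      : kObj K
    p₁      : kHom EH E
    p₂      : kHom EH H
    isProd  : IsProduct E H EH p₁ p₂
    ev      : kHom EH G
    curry   : {X XH : kObj K} {q₁ : kHom XH X} {q₂ : kHom XH H} →
              IsProduct X H XH q₁ q₂ → kHom XH G → kHom X E
    curry-β : {X XH : kObj K} {q₁ : kHom XH X} {q₂ : kHom XH H}
              (P : IsProduct X H XH q₁ q₂) (f : kHom XH G) →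
              ev ∘ IsProduct.⟨_,_⟩ isProd (curry P f ∘ q₁) q₂ ≈ f
    curry-η : {X XH : kObj K} {q₁ : kHom XH X} {q₂ : kHom XH H}
              (P : IsProduct X H XH q₁ q₂) (f : kHom XH G) (g : kHom X E) →
              ev ∘ IsProduct.⟨_,_⟩ isProd (g ∘ q₁) q₂ ≈ f → g ≈ curry P f

HasExponentials : Set → Set₁
HasExponentials K = (G H : kObj K) → Exponential G H

CardGt1 : Set → Set
CardGt1 K = Σ K λ a → Σ K λ b → ¬ (a ≡ b)

module Submission where

-- Let 𝟙 be the hypergraph with one vertex and no edges; it is
-- k-uniform vacuously.  For every object A, the edgeless hypergraph on the
-- vertices of A ("A with its edges deleted") is a product A × 𝟙, because a
-- morphism into 𝟙 forces its domain to have no edges.  Suppose the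
-- exponential E = 𝟙^𝟙 exists.
--   * Vertices of E are morphisms 𝟙 → E, and each of them is a curried form
--     of the unique map 𝟙 × 𝟙 → 𝟙; uniqueness of currying makes E have at
--     most one vertex.
--   * Currying the unique map Δ × 𝟙 → 𝟙, where Δ is the single edge on K
--     vertices, gives a morphism Δ → E, so E has an edge e.
-- By k-uniformity φ(e) ≅ K, but φ(e) is a subsingleton since E has at most
-- one vertex; hence K has at most one element, contradicting k > 1.
-- The file first treats edgeless objects and the product A × 𝟙, then the
-- two facts about 𝟙^𝟙, then the uniformity argument, and finally the theorem.

open import Defs
open import Relation.Nullary using (¬_)
open import Data.Empty using (⊥; ⊥-elim)
open import Data.Unit using (⊤; tt)
open import Data.Product using (_,_; proj₂)
open import Relation.Binary.PropositionalEquality using (_≡_; refl; sym; trans; cong)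
open import Function.Bundles using (Inverse; mk↔ₛ′)

Edgeless : Hypergraph → Set
Edgeless H = Edge H → ⊥

discreteOn : (K V : Set) → kObj K
discreteOn K V = kobj
  (record { Edge = ⊥ ; Vertex = V ; φ = λ () ; φ-prop = λ () }) (λ ())

𝟙 : (K : Set) → kObj K
𝟙 K = discreteOn K ⊤

discrete : {K : Set} → kObj K → kObj K
discrete {K} A = discreteOn K (Vertex (hg A))

simplex : (K : Set) → kObj K
simplex K = kobj
  (record { Edge = ⊤ ; Vertex = K ; φ = λ _ _ → ⊤ ; φ-prop = λ _ _ _ _ → refl })
  (λ _ → mk↔ₛ′ (λ (k , _) → k) (λ k → k , tt) (λ _ → refl) (λ _ → refl))

edgelessHom : {K : Set} {A B : kObj K} → Edgeless (hg A) →
              (Vertex (hg A) → Vertex (hg B)) → kHom A B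
edgelessHom noEdge f = khom (record
  { fE = λ e → ⊥-elim (noEdge e) ; fV = f ; comm = λ e → ⊥-elim (noEdge e) })

edgeless-≈ : {K : Set} {A B : kObj K} → Edgeless (hg A) → (f g : kHom A B) →
             (∀ v → fV (hom f) v ≡ fV (hom g) v) → f ≈ g
edgeless-≈ noEdge f g sameV = (λ e → ⊥-elim (noEdge e)) , sameV

edgeless-domain : {K : Set} {A B : kObj K} → Edgeless (hg B) → kHom A B →
                  Edgeless (hg A)
edgeless-domain noEdge f e = noEdge (fE (hom f) e)

discreteFst : {K : Set} (A : kObj K) → kHom (discrete A) A
discreteFst A = edgelessHom (λ ()) (λ v → v)

toPoint : {K : Set} (A : kObj K) → kHom (discrete A) (𝟙 K)
toPoint A = edgelessHom (λ ()) (λ _ → tt)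

discrete-isProduct : {K : Set} (A : kObj K) →
                     IsProduct A (𝟙 K) (discrete A) (discreteFst A) (toPoint A)
discrete-isProduct {K} A = record
  { ⟨_,_⟩  = pair
  ; β₁     = λ f g → edgeless-≈ (noEdge g) (discreteFst A ∘ pair f g) f (λ _ → refl)
  ; β₂     = λ f g → edgeless-≈ (noEdge g) (toPoint A ∘ pair f g) g (λ _ → refl)
  ; unique = λ f g h π₁h≈f _ → edgeless-≈ (noEdge g) h (pair f g) (proj₂ π₁h≈f)
  }
  where
  noEdge : {X : kObj K} → kHom X (𝟙 K) → Edgeless (hg X)
  noEdge = edgeless-domain (λ ())
  pair : {X : kObj K} → kHom X A → kHom X (𝟙 K) → kHom X (discrete A)
  pair f g = edgelessHom (noEdge g) (fV (hom f))

module PointExponential {K : Set} (exp : Exponential (𝟙 K) (𝟙 K)) where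
  open Exponential exp
  open IsProduct isProd using (⟨_,_⟩)

  pointAt : Vertex (hg E) → kHom (𝟙 K) E
  pointAt u = edgelessHom (λ ()) (λ _ → u)

  curriedVertex : Vertex (hg E)
  curriedVertex = fV (hom (curry (discrete-isProduct (𝟙 K)) (toPoint (𝟙 K)))) tt

  -- Each point of E trivially uncurries to that map, so by uniqueness of
  -- currying it is the curried vertex.
  is-curriedVertex : ∀ u → u ≡ curriedVertex
  is-curriedVertex u =
    proj₂ (curry-η (discrete-isProduct (𝟙 K)) (toPoint (𝟙 K)) (pointAt u) uncurries) tt
    where
    uncurries : ev ∘ ⟨ pointAt u ∘ discreteFst (𝟙 K) , toPoint (𝟙 K) ⟩ ≈ toPoint (𝟙 K)
    uncurries = edgeless-≈ (λ ())
      (ev ∘ ⟨ pointAt u ∘ discreteFst (𝟙 K) , toPoint (𝟙 K) ⟩) (toPoint (𝟙 K)) (λ _ → refl)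

  vertex-unique : (u w : Vertex (hg E)) → u ≡ w
  vertex-unique u w = trans (is-curriedVertex u) (sym (is-curriedVertex w))

  -- Currying toPoint on the simplex yields a morphism simplex → E, so E has
  -- an edge.
  edge : Edge (hg E)
  edge = fE (hom (curry (discrete-isProduct (simplex K)) (toPoint (simplex K)))) tt

member-unique : (H : Hypergraph) → (∀ (u w : Vertex H) → u ≡ w) →
                ∀ e (x y : ⟦ H ⟧ e) → x ≡ y
member-unique H sameVertex e (u , p) (w , q) with sameVertex u w
... | refl = cong (u ,_) (φ-prop H e u p q)

uniform-subsingleton : {K : Set} (A : kObj K) → Edge (hg A) →
                       (∀ (u w : Vertex (hg A)) → u ≡ w) → (a b : K) → a ≡ b
uniform-subsingleton A e sameVertex a b = begin
    a                  ≡⟨ sym (strictlyInverseˡ a) ⟩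
    to (from a)        ≡⟨ cong to (member-unique (hg A) sameVertex e (from a) (from b)) ⟩
    to (from b)        ≡⟨ strictlyInverseˡ b ⟩
    b                  ∎
  where
  open Relation.Binary.PropositionalEquality.≡-Reasoning
  open Inverse (uniform A e)

corollary5p6 : (K : Set) → CardGt1 K → ¬ HasExponentials K
corollary5p6 K (a , b , a≢b) hasExp =
  a≢b (uniform-subsingleton E edge vertex-unique a b)
  where
  exp : Exponential (𝟙 K) (𝟙 K)
  exp = hasExp (𝟙 K) (𝟙 K)
  open PointExponential exp using (edge; vertex-unique)
  open Exponential exp using (E)
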